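{- Let $m\ge 0$ be an integer and $k=4m+3$. Let $n\ge 0$, and let $x_i,y_i,z_i\in\{0,1\}$ for $i=0,\dots,n$. For $t=0,1,\dots,n$ define $S_t=\sum_{i=n-t}^{n}(x_i+z_i-ky_i)2^i$. Let $t\in\{0,\dots,n\}$ and suppose that $x_i\oplus y_i\oplus z_i=0$ for $i=n,n-1,\dots,n-t$ and that $S_t<0$. Then $S_j<0$ for every integer $j$ with $t<j\le n$.
   Context: $\oplus$ denotes nim-sum (XOR); for bits this is addition modulo 2. -}

module Defs where

open import Data.Nat using (ℕ; _≤?_; _∸_)
open import Data.Bool using (Bool; true; false; _xor_)
open import Data.Fin using (Fin; toℕ)
open import Data.List using (List; map; sum; allFin)
open import Data.Integer using (ℤ; +_; _+_; _-_; _*_)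
open import Relation.Nullary.Decidable using (does)
open import Data.Bool using (if_then_else_)

bit : Bool → ℤ
bit true  = + 1
bit false = + 0

sumℤ : List ℤ → ℤ
sumℤ = Data.List.foldr _+_ (+ 0)

term : (k : ℕ) → Bool → Bool → Bool → ℕ → ℤ
term k xi yi zi i = (bit xi + bit zi - (+ k) * bit yi) * (+ (2 Data.Nat.^ i))

S : (n k : ℕ) → (x y z : Fin (ℕ.suc n) → Bool) → ℕ → ℤ
S n k x y z t =
  sumℤ (map (λ i → if does ((n ∸ t) ≤? toℕ i)
                      then term k (x i) (y i) (z i) (toℕ i)
                      else + 0)
            (allFin (ℕ.suc n)))

xor3 : Bool → Bool → Bool → Bool
xor3 a b c = (a xor b) xor c

module Submission where

-- With a = n ∸ t, every summand of S_t has index i ≥ a and an even coefficient (k is odd and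
-- x_i ⊕ y_i ⊕ z_i = 0), so 2^(a+1) divides S_t; being negative, S_t ≤ -2^(a+1).  Each new
-- summand of index i is at most 2^(i+1), so the bound S_j ≤ -2^(n-j+1) propagates from j to j+1:
-- -2^(e+1) + 2^e = -2^e.

open import Defs
open import Data.Nat using (ℕ; zero; suc; _+_; _*_; _^_; _≤_; _<_; _∸_; _≤′_; ≤′-refl; ≤′-step; _≤?_; z≤n; s≤s)
open import Data.Nat.Properties
  using (m∸n≤m; +-∸-assoc; ^-distribˡ-+-*; m∸n+n≡m; m^n>0; +-identityʳ; ≤⇒≤′; <⇒≤)
import Data.Nat.Divisibility as ℕ
open import Data.Nat.Tactic.RingSolver using () renaming (solve-∀ to ℕ-solve-∀)
open import Data.Bool using (Bool; true; false; if_then_else_)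
open import Data.Fin using (Fin; toℕ; fromℕ<) renaming (zero to fzero; suc to fsuc)
open import Data.Fin.Properties using (toℕ-fromℕ<)
open import Data.Integer using (ℤ; +_; -[1+_]; 0ℤ; -_; _-_; +≤+; +<+)
  renaming (_+_ to _+ℤ_; _*_ to _*ℤ_; _≤_ to _≤ℤ_; _<_ to _<ℤ_)
open import Data.Integer.Properties
  using (+-identityˡ; *-zeroˡ; pos-+; pos-*; i≤j⇒i-k≤j; +-mono-≤; +-monoˡ-≤; +-monoʳ-≤;
         *-monoʳ-≤-nonNeg; neg-mono-≤; neg-mono-<; ≤-<-trans; module ≤-Reasoning)
open import Data.Integer.Divisibility.Signed
  using (_∣_; divides; ∣ᵤ⇒∣; ∣⇒∣ᵤ; ∣m∣n⇒∣m+n; ∣n⇒∣m*n; ∣-refl; ∣-trans; *-monoˡ-∣)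
open import Data.Integer.Tactic.RingSolver using (solve-∀)
open import Data.List using (tabulate)
open import Data.List.Properties using (map-tabulate; tabulate-cong)
open import Data.List.Relation.Unary.All using (All; []; _∷_)
open import Data.List.Relation.Unary.All.Properties using (tabulate⁺)
open import Relation.Nullary using (Dec; does; yes; no)
open import Relation.Binary.PropositionalEquality
  using (_≡_; refl; sym; trans; cong; subst; subst₂; module ≡-Reasoning)
open import Function using (_∘_; id)

tailSum : ∀ {N} → (Fin N → ℤ) → ℕ → ℤ
tailSum g l = sumℤ (tabulate λ i → if does (l ≤? toℕ i) then g i else 0ℤ)

does-≤?-suc : ∀ l i → does (suc l ≤? suc i) ≡ does (l ≤? i)
does-≤?-suc zero    i = refl
does-≤?-suc (suc l) i = refl

tailSum-suc : ∀ {N} (g : Fin (suc N) → ℤ) l → tailSum g (suc l) ≡ tailSum (g ∘ fsuc) l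
tailSum-suc g l = trans (+-identityˡ _)
  (cong sumℤ (tabulate-cong λ i → cong (if_then g (fsuc i) else 0ℤ) (does-≤?-suc l (toℕ i))))

tailSum-split : ∀ {N} (g : Fin N → ℤ) {l} (l<N : l < N) →
  tailSum g l ≡ g (fromℕ< l<N) +ℤ tailSum g (suc l)
tailSum-split {suc N} g {zero}  _ = cong (g fzero +ℤ_) (sym (tailSum-suc g 0))
tailSum-split {suc N} g {suc l} (s≤s l<N) = begin
  tailSum g (suc l)                                   ≡⟨ tailSum-suc g l ⟩
  tailSum (g ∘ fsuc) l                                ≡⟨ tailSum-split (g ∘ fsuc) l<N ⟩
  g (fsuc (fromℕ< l<N)) +ℤ tailSum (g ∘ fsuc) (suc l)
    ≡⟨ cong (g (fsuc (fromℕ< l<N)) +ℤ_) (sym (tailSum-suc g (suc l))) ⟩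
  g (fsuc (fromℕ< l<N)) +ℤ tailSum g (suc (suc l))    ∎
  where open ≡-Reasoning

sumℤ-∣ : ∀ {d xs} → All (d ∣_) xs → d ∣ sumℤ xs
sumℤ-∣ {d} []       = divides 0ℤ (sym (*-zeroˡ d))
sumℤ-∣     (p ∷ ps) = ∣m∣n⇒∣m+n p (sumℤ-∣ ps)

tailSum-∣ : ∀ {N d l} (g : Fin N → ℤ) → (∀ i → l ≤ toℕ i → d ∣ g i) → d ∣ tailSum g l
tailSum-∣ {d = d} {l} g dvd = sumℤ-∣ (tabulate⁺ λ i → guarded i (l ≤? toℕ i))
  where
  guarded : ∀ i (l≤?i : Dec (l ≤ toℕ i)) → d ∣ (if does l≤?i then g i else 0ℤ)
  guarded i (yes l≤i) = dvd i l≤i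
  guarded i (no  _)   = divides 0ℤ (sym (*-zeroˡ d))

^-monoʳ-∣ : ∀ m {a b} → a ≤ b → m ^ a ℕ.∣ m ^ b
^-monoʳ-∣ m {a} {b} a≤b = ℕ.divides (m ^ (b ∸ a))
  (trans (cong (m ^_) (sym (m∸n+n≡m a≤b))) (^-distribˡ-+-* m (b ∸ a) a))

bit≤1 : ∀ b → bit b ≤ℤ + 1
bit≤1 false = +≤+ z≤n
bit≤1 true  = +≤+ (s≤s z≤n)

coefficient≤2 : ∀ k x y z → bit x +ℤ bit z - + k *ℤ bit y ≤ℤ + 2
coefficient≤2 k x false z = subst (λ w → bit x +ℤ bit z - w ≤ℤ + 2) (pos-* k 0)
  (i≤j⇒i-k≤j (+ (k * 0)) (+-mono-≤ (bit≤1 x) (bit≤1 z)))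
coefficient≤2 k x true  z = subst (λ w → bit x +ℤ bit z - w ≤ℤ + 2) (pos-* k 1)
  (i≤j⇒i-k≤j (+ (k * 1)) (+-mono-≤ (bit≤1 x) (bit≤1 z)))

term≤ : ∀ k x y z i → term k x y z i ≤ℤ + (2 ^ suc i)
term≤ k x y z i = subst (term k x y z i ≤ℤ_) (sym (pos-* 2 (2 ^ i)))
  (*-monoʳ-≤-nonNeg (+ (2 ^ i)) (coefficient≤2 k x y z))

bits-even : ∀ x y z → xor3 x y z ≡ false → + 2 ∣ bit x +ℤ bit z - bit y
bits-even false false false _ = divides 0ℤ refl
bits-even true  false true  _ = divides (+ 1) refl
bits-even true  true  false _ = divides 0ℤ refl
bits-even false true  true  _ = divides 0ℤ refl

coefficient-even : ∀ ρ x y z → xor3 x y z ≡ false →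
  + 2 ∣ bit x +ℤ bit z - (+ 1 +ℤ + 2 *ℤ ρ) *ℤ bit y
coefficient-even ρ x y z h = subst (+ 2 ∣_) (sym (odd-coefficient (bit x) (bit y) (bit z) ρ))
  (∣m∣n⇒∣m+n (bits-even x y z h) (∣n⇒∣m*n (- ρ *ℤ bit y) (∣-refl {+ 2})))
  where
  odd-coefficient : ∀ a b c ρ →
    a +ℤ c - (+ 1 +ℤ + 2 *ℤ ρ) *ℤ b ≡ (a +ℤ c - b) +ℤ (- ρ *ℤ b) *ℤ + 2
  odd-coefficient = solve-∀

term-∣ : ∀ r x y z i → xor3 x y z ≡ false → + (2 ^ suc i) ∣ term (suc (2 * r)) x y z i
term-∣ r x y z i h = subst₂ _∣_ (sym (pos-* 2 (2 ^ i)))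
  (cong (λ K → (bit x +ℤ bit z - K *ℤ bit y) *ℤ + (2 ^ i)) (sym odd))
  (*-monoˡ-∣ (+ (2 ^ i)) (coefficient-even (+ r) x y z h))
  where
  odd : + suc (2 * r) ≡ + 1 +ℤ + 2 *ℤ + r
  odd = trans (pos-+ 1 (2 * r)) (cong (+ 1 +ℤ_) (pos-* 2 r))

∣∧<0⇒≤-divisor : ∀ d {s} → + d ∣ s → s <ℤ 0ℤ → s ≤ℤ - + d
∣∧<0⇒≤-divisor d { + _}     _   (+<+ ())
∣∧<0⇒≤-divisor d { -[1+ r ]} d∣s _ = neg-mono-≤ (+≤+ (ℕ.∣⇒≤ (∣⇒∣ᵤ d∣s)))

-2^<0 : ∀ e → - + (2 ^ e) <ℤ 0ℤ
-2^<0 e = neg-mono-< (+<+ (m^n>0 2 e))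

+2^suc≡2^+2^ : ∀ e → + (2 ^ suc e) ≡ + (2 ^ e) +ℤ + (2 ^ e)
+2^suc≡2^+2^ e = trans (cong (λ w → + (2 ^ e + w)) (+-identityʳ (2 ^ e))) (pos-+ (2 ^ e) (2 ^ e))

module _ (n k : ℕ) (x y z : Fin (suc n) → Bool) where

  termAt : Fin (suc n) → ℤ
  termAt i = term k (x i) (y i) (z i) (toℕ i)

  S≡tailSum : ∀ t → S n k x y z t ≡ tailSum termAt (n ∸ t)
  S≡tailSum t = cong sumℤ (map-tabulate id λ i →
    if does ((n ∸ t) ≤? toℕ i) then termAt i else 0ℤ)

  S-suc≤ : ∀ {j} → j < n → S n k x y z (suc j) ≤ℤ + (2 ^ (n ∸ j)) +ℤ S n k x y z j
  S-suc≤ {j} j<n = begin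
    S n k x y z (suc j)                    ≡⟨ S≡tailSum (suc j) ⟩
    tailSum termAt (n ∸ suc j)             ≡⟨ tailSum-split termAt l<1+n ⟩
    termAt i +ℤ tailSum termAt (suc (n ∸ suc j))
      ≡⟨ cong (λ l → termAt i +ℤ tailSum termAt l) (sym n∸j≡1+[n∸1+j]) ⟩
    termAt i +ℤ tailSum termAt (n ∸ j)     ≡⟨ cong (termAt i +ℤ_) (sym (S≡tailSum j)) ⟩
    termAt i +ℤ S n k x y z j              ≤⟨ +-monoˡ-≤ (S n k x y z j) termAt-i≤ ⟩
    + (2 ^ (n ∸ j)) +ℤ S n k x y z j       ∎
    where
    open ≤-Reasoning
    l<1+n : n ∸ suc j < suc n
    l<1+n = s≤s (m∸n≤m n (suc j))
    i : Fin (suc n)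
    i = fromℕ< l<1+n
    n∸j≡1+[n∸1+j] : n ∸ j ≡ suc (n ∸ suc j)
    n∸j≡1+[n∸1+j] = +-∸-assoc 1 j<n
    termAt-i≤ : termAt i ≤ℤ + (2 ^ (n ∸ j))
    termAt-i≤ = subst (λ e → termAt i ≤ℤ + (2 ^ e))
      (trans (cong suc (toℕ-fromℕ< l<1+n)) (sym n∸j≡1+[n∸1+j]))
      (term≤ k (x i) (y i) (z i) (toℕ i))

  S≤-2^-propagates : ∀ {t j} → S n k x y z t ≤ℤ - + (2 ^ suc (n ∸ t)) → t ≤′ j → j ≤ n →
    S n k x y z j ≤ℤ - + (2 ^ suc (n ∸ j))
  S≤-2^-propagates St≤ ≤′-refl _ = St≤
  S≤-2^-propagates St≤ (≤′-step {j} t≤j) j<n = begin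
    S n k x y z (suc j)                    ≤⟨ S-suc≤ j<n ⟩
    P +ℤ S n k x y z j                     ≤⟨ +-monoʳ-≤ P (S≤-2^-propagates St≤ t≤j (<⇒≤ j<n)) ⟩
    P +ℤ - + (2 ^ suc (n ∸ j))             ≡⟨ cong (λ w → P +ℤ - w) (+2^suc≡2^+2^ (n ∸ j)) ⟩
    P +ℤ - (P +ℤ P)                        ≡⟨ halve P ⟩
    - P                                    ≡⟨ cong (λ e → - + (2 ^ e)) (+-∸-assoc 1 j<n) ⟩
    - + (2 ^ suc (n ∸ suc j))              ∎
    where
    open ≤-Reasoning
    P : ℤ
    P = + (2 ^ (n ∸ j))
    halve : ∀ p → p +ℤ - (p +ℤ p) ≡ - p
    halve = solve-∀

module _ (r n : ℕ) (x y z : Fin (suc n) → Bool) where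

  S-∣ : ∀ t → (∀ i → n ∸ t ≤ toℕ i → xor3 (x i) (y i) (z i) ≡ false) →
    + (2 ^ suc (n ∸ t)) ∣ S n (suc (2 * r)) x y z t
  S-∣ t xor≡0 = subst (+ (2 ^ suc (n ∸ t)) ∣_) (sym (S≡tailSum n (suc (2 * r)) x y z t))
    (tailSum-∣ (termAt n (suc (2 * r)) x y z) λ i l≤i →
      ∣-trans (∣ᵤ⇒∣ (^-monoʳ-∣ 2 (s≤s l≤i))) (term-∣ r (x i) (y i) (z i) (toℕ i) (xor≡0 i l≤i)))

  S-negative-persists : ∀ t → (∀ i → n ∸ t ≤ toℕ i → xor3 (x i) (y i) (z i) ≡ false) →
    S n (suc (2 * r)) x y z t <ℤ 0ℤ → ∀ j → t ≤ j → j ≤ n → S n (suc (2 * r)) x y z j <ℤ 0ℤ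
  S-negative-persists t xor≡0 St<0 j t≤j j≤n =
    ≤-<-trans (S≤-2^-propagates n (suc (2 * r)) x y z St≤ (≤⇒≤′ t≤j) j≤n) (-2^<0 (suc (n ∸ j)))
    where
    St≤ : S n (suc (2 * r)) x y z t ≤ℤ - + (2 ^ suc (n ∸ t))
    St≤ = ∣∧<0⇒≤-divisor (2 ^ suc (n ∸ t)) (S-∣ t xor≡0) St<0

4m+3≡1+2[2m+1] : ∀ m → 4 * m + 3 ≡ suc (2 * (2 * m + 1))
4m+3≡1+2[2m+1] = ℕ-solve-∀

lemma2p4 : (m : ℕ) → (n : ℕ) → (x y z : Fin (suc n) → Bool) → (t : ℕ) → t ≤ n
    → (∀ (i : Fin (suc n)) → n ∸ t ≤ toℕ i → xor3 (x i) (y i) (z i) ≡ false)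
    → S n (4 * m + 3) x y z t Data.Integer.< Data.Integer.0ℤ
    → ∀ (j : ℕ) → t < j → j ≤ n → S n (4 * m + 3) x y z j Data.Integer.< Data.Integer.0ℤ
lemma2p4 m n x y z t _ xor≡0 St<0 j t<j j≤n rewrite 4m+3≡1+2[2m+1] m =
  S-negative-persists (2 * m + 1) n x y z t xor≡0 St<0 j (<⇒≤ t<j) j≤n
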